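{- Let $G$ be an $n$-vertex $K_4$-saturated graph with minimum degree $\delta(G)=4$, let $x$ be a vertex of degree $4$ with $N(x)=\{x_1,x_2,x_3,x_4\}$, and let $Y = V(G)\setminus(\{x\}\cup N(x))$. For $S \subseteq \{1,2,3,4\}$ let $V_S$ be the set of $y \in Y$ such that $y$ is adjacent to $x_i$ if and only if $i \in S$. Let $S \subset \{1,2,3,4\}$ and $i \in \{1,2,3,4\}\setminus S$, and let $\mathcal{T}_{S,i}$ be the set of all $T \subseteq \{1,2,3,4\}$ such that $i \in T$ and, for all $j,k \in S$ with $x_jx_k \in E(G)$, $|T \cap \{j,k\}| \leq 1$. If $V_S \neq \emptyset$, then every $y \in V_S$ is adjacent to some vertex in $\bigcup_{T \in \mathcal{T}_{S,i}} V_T$; in particular this union is nonempty.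
   Context: A graph $G$ is $K_4$-saturated if $G$ contains no copy of $K_4$ but adding any edge between two nonadjacent vertices creates a copy of $K_4$. -}

module Defs where

open import Data.Nat using (ℕ; _≤_)
open import Data.Bool using (Bool; true; false; _∨_; _∧_)
open import Data.Fin using (Fin)
open import Data.Fin.Properties using (_≟_)
open import Data.Fin.Subset using (Subset; _∈_; _∉_; ∣_∣; _∩_; _∪_; ⁅_⁆)
open import Data.List using (length; filterᵇ; allFin)
open import Data.Product using (Σ; _×_; ∃; ∃-syntax)
open import Relation.Binary.PropositionalEquality using (_≡_; _≢_)
open import Relation.Nullary using (¬_; does)
open import Function.Bundles using (_⇔_)

record Graph (n : ℕ) : Set where
  field
    adj    : Fin n → Fin n → Bool
    sym    : ∀ u v → adj u v ≡ adj v u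
    irrefl : ∀ v → adj v v ≡ false
open Graph public

Rel𝔹 : ℕ → Set
Rel𝔹 n = Fin n → Fin n → Bool

Adjᵣ : ∀ {n} → Rel𝔹 n → Fin n → Fin n → Set
Adjᵣ r u v = r u v ≡ true

Adj : ∀ {n} → Graph n → Fin n → Fin n → Set
Adj G = Adjᵣ (adj G)

HasK4 : ∀ {n} → Rel𝔹 n → Set
HasK4 {n} r = Σ (Fin n) λ a → Σ (Fin n) λ b → Σ (Fin n) λ c → Σ (Fin n) λ d →
  (a ≢ b) × (a ≢ c) × (a ≢ d) × (b ≢ c) × (b ≢ d) × (c ≢ d) ×
  Adjᵣ r a b × Adjᵣ r a c × Adjᵣ r a d × Adjᵣ r b c × Adjᵣ r b d × Adjᵣ r c d

addEdge : ∀ {n} → Graph n → Fin n → Fin n → Rel𝔹 n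
addEdge G u v a b =
  adj G a b ∨ ((does (a ≟ u) ∧ does (b ≟ v)) ∨ (does (a ≟ v) ∧ does (b ≟ u)))

K4-saturated : ∀ {n} → Graph n → Set
K4-saturated {n} G =
  ¬ HasK4 (adj G) ×
  (∀ (u v : Fin n) → u ≢ v → ¬ Adj G u v → HasK4 (addEdge G u v))

degree : ∀ {n} → Graph n → Fin n → ℕ
degree {n} G v = length (filterᵇ (adj G v) (allFin n))

minDegree4 : ∀ {n} → Graph n → Set
minDegree4 {n} G = (∀ v → 4 ≤ degree G v) × (∃[ v ] degree G v ≡ 4)

-- Setting: x of degree 4 with N(x) = {xs 0, …, xs 3}, xs injective.
-- Y = V(G) ∖ ({x} ∪ N(x)).
InY : ∀ {n} → Graph n → Fin n → Fin n → Set
InY G x y = (y ≢ x) × ¬ Adj G x y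

InV : ∀ {n} → Graph n → Fin n → (Fin 4 → Fin n) → Subset 4 → Fin n → Set
InV G x xs S y = InY G x y × (∀ i → Adj G y (xs i) ⇔ (i ∈ S))

In𝒯 : ∀ {n} → Graph n → (Fin 4 → Fin n) → Subset 4 → Fin 4 → Subset 4 → Set
In𝒯 G xs S i T =
  (i ∈ T) ×
  (∀ j k → j ∈ S → k ∈ S → Adj G (xs j) (xs k) → ∣ T ∩ (⁅ j ⁆ ∪ ⁅ k ⁆) ∣ ≤ 1)

-- Let y ∈ V_S and i ∉ S.  Then y ≁ xᵢ, so adding the edge y xᵢ
-- creates a K₄; since G itself is K₄-free this K₄ must use the new edge,
-- and its two other vertices p, q form an edge of G whose ends are both
-- adjacent to y and to xᵢ.  The vertices x, xᵢ, p, q cannot all be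
-- pairwise adjacent, so one of p, q — call it z — is not adjacent to x;
-- hence z ∈ Y, and z ∈ V_T for T the trace of N(z) on N(x).  Then i ∈ T
-- (z ~ xᵢ), and T meets each edge xⱼxₖ with j, k ∈ S in at most one
-- index, since otherwise y, z, xⱼ, xₖ would be a K₄.
--
-- Only K₄-saturation and the description
-- of N(x) are used.
module Submission where

open import Defs
open import Data.Nat using (ℕ; _≤_)
open import Data.Bool using (true; false; _∨_; _∧_)
open import Data.Bool.Properties using (∨-comm; ∧-comm) renaming (_≟_ to _≟𝔹_)
open import Data.Fin using (Fin)
open import Data.Fin.Properties using (_≟_)
open import Data.Fin.Subset using (Subset; _∈_; _∉_; _⊆_; ∣_∣; _∩_; _∪_; ⁅_⁆)
open import Data.Fin.Subset.Properties
  using (_∈?_; ∪-comm; x∈p∩q⁻; x∈p∪q⁻; x∈⁅y⁆⇒x≡y; ∣⁅x⁆∣≡1; p⊆q⇒∣p∣≤∣q∣)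
open import Data.Vec using (tabulate)
open import Data.Vec.Properties using (lookup∘tabulate; lookup⇒[]=; []=⇒lookup)
open import Data.Product using (_×_; ∃-syntax; _,_)
open import Data.Sum using (_⊎_; inj₁; inj₂)
open import Data.Empty using (⊥-elim)
open import Relation.Binary.PropositionalEquality
  using (_≡_; _≢_; refl; trans; cong₂; subst; ≢-sym) renaming (sym to ≡-sym)
open import Relation.Nullary using (¬_; Dec; yes; no; does; contradiction)
open import Function.Definitions using (Injective)
open import Function.Bundles using (_⇔_; mk⇔; Equivalence)

module _ {n : ℕ} (G : Graph n) where

  adj? : ∀ a b → Dec (Adj G a b)
  adj? a b = adj G a b ≟𝔹 true

  adj-sym : ∀ {a b} → Adj G a b → Adj G b a
  adj-sym {a} {b} ab = trans (Graph.sym G b a) ab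

  adj⇒≢ : ∀ {a b} → Adj G a b → a ≢ b
  adj⇒≢ {a} a~a refl = contradiction (trans (≡-sym a~a) (irrefl G a)) λ ()

  K4-of : ∀ {a b c d} → Adj G a b → Adj G a c → Adj G a d →
    Adj G b c → Adj G b d → Adj G c d → HasK4 (adj G)
  K4-of {a} {b} {c} {d} ab ac ad bc bd cd =
    a , b , c , d , adj⇒≢ ab , adj⇒≢ ac , adj⇒≢ ad , adj⇒≢ bc , adj⇒≢ bd , adj⇒≢ cd ,
    ab , ac , ad , bc , bd , cd

  triangle-escapes : ¬ HasK4 (adj G) → ∀ {x w p q} → Adj G x w →
    Adj G p q → Adj G w p → Adj G w q → ¬ Adj G x p ⊎ ¬ Adj G x q
  triangle-escapes K4-free {x} {w} {p} {q} xw pq wp wq with adj? x p | adj? x q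
  ... | no x≁p | _        = inj₁ x≁p
  ... | yes _  | no x≁q   = inj₂ x≁q
  ... | yes xp | yes xq   = ⊥-elim (K4-free (K4-of xw xp xq wp wq pq))

  CommonEdge : Fin n → Fin n → Set
  CommonEdge u v =
    ∃[ p ] ∃[ q ] (Adj G p q × Adj G p u × Adj G p v × Adj G q u × Adj G q v)

  module _ (u v : Fin n) where

    _~⁺_ : Fin n → Fin n → Set
    _~⁺_ = Adjᵣ (addEdge G u v)

    ~⁺-sym : ∀ {a b} → a ~⁺ b → b ~⁺ a
    ~⁺-sym {a} {b} ab = trans (cong₂ _∨_ (Graph.sym G b a) (new-pair-sym b a)) ab
      where
      new-pair-sym : ∀ a b →
        (does (a ≟ u) ∧ does (b ≟ v)) ∨ (does (a ≟ v) ∧ does (b ≟ u)) ≡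
        (does (b ≟ u) ∧ does (a ≟ v)) ∨ (does (b ≟ v) ∧ does (a ≟ u))
      new-pair-sym a b = trans
        (cong₂ _∨_ (∧-comm (does (a ≟ u)) _) (∧-comm (does (a ≟ v)) _))
        (∨-comm (does (b ≟ v) ∧ does (a ≟ u)) _)

    new-edge : ∀ {a b} → a ~⁺ b → ¬ Adj G a b → (a ≡ u × b ≡ v) ⊎ (a ≡ v × b ≡ u)
    new-edge {a} {b} ab a≁b with adj G a b | a ≟ u | b ≟ v | a ≟ v | b ≟ u
    ... | true  | _     | _     | _     | _     = ⊥-elim (a≁b refl)
    ... | false | yes p | yes q | _     | _     = inj₁ (p , q)
    ... | false | _     | _     | yes p | yes q = inj₂ (p , q)
    ... | false | no _  | _     | no _  | _     = contradiction ab λ ()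
    ... | false | no _  | _     | yes _ | no _  = contradiction ab λ ()
    ... | false | yes _ | no _  | no _  | _     = contradiction ab λ ()
    ... | false | yes _ | no _  | yes _ | no _  = contradiction ab λ ()

    old-edge : ∀ {a b} → a ~⁺ b → a ≢ u → a ≢ v → Adj G a b
    old-edge {a} {b} ab a≢u a≢v with adj? a b
    ... | yes a~b = a~b
    ... | no a≁b with new-edge ab a≁b
    ...   | inj₁ (a≡u , _) = contradiction a≡u a≢u
    ...   | inj₂ (a≡v , _) = contradiction a≡v a≢v

    -- A K₄ of G + uv through the new edge e₁e₂ = uv: its other two
    -- vertices c, d lie outside {u, v}, so all their edges are old.
    K4-through-new-edge : ∀ {e₁ e₂ c d} → e₁ ~⁺ e₂ → ¬ Adj G e₁ e₂ →
      c ≢ e₁ → c ≢ e₂ → d ≢ e₁ → d ≢ e₂ →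
      c ~⁺ d → c ~⁺ e₁ → c ~⁺ e₂ → d ~⁺ e₁ → d ~⁺ e₂ → CommonEdge u v
    K4-through-new-edge {c = c} {d} e e₁≁e₂ c≢e₁ c≢e₂ d≢e₁ d≢e₂ cd ce₁ ce₂ de₁ de₂
      with new-edge e e₁≁e₂
    ... | inj₁ (refl , refl) =
      c , d , old-edge cd c≢e₁ c≢e₂ ,
      old-edge ce₁ c≢e₁ c≢e₂ , old-edge ce₂ c≢e₁ c≢e₂ ,
      old-edge de₁ d≢e₁ d≢e₂ , old-edge de₂ d≢e₁ d≢e₂
    ... | inj₂ (refl , refl) =
      c , d , old-edge cd c≢e₂ c≢e₁ ,
      old-edge ce₂ c≢e₂ c≢e₁ , old-edge ce₁ c≢e₂ c≢e₁ ,
      old-edge de₂ d≢e₂ d≢e₁ , old-edge de₁ d≢e₂ d≢e₁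

    -- If G is K₄-free, every K₄ of G + uv uses the new edge, hence
    -- u and v have an edge of common neighbours.
    common-edge : ¬ HasK4 (adj G) → HasK4 (addEdge G u v) → CommonEdge u v
    common-edge K4-free
      (a , b , c , d , a≢b , a≢c , a≢d , b≢c , b≢d , c≢d , ab , ac , ad , bc , bd , cd)
      with adj? a b | adj? a c | adj? a d | adj? b c | adj? b d | adj? c d
    ... | no a≁b | _ | _ | _ | _ | _ =
      K4-through-new-edge ab a≁b (≢-sym a≢c) (≢-sym b≢c) (≢-sym a≢d) (≢-sym b≢d)
        cd (~⁺-sym ac) (~⁺-sym bc) (~⁺-sym ad) (~⁺-sym bd)
    ... | yes _ | no a≁c | _ | _ | _ | _ =
      K4-through-new-edge ac a≁c (≢-sym a≢b) b≢c (≢-sym a≢d) (≢-sym c≢d)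
        bd (~⁺-sym ab) bc (~⁺-sym ad) (~⁺-sym cd)
    ... | yes _ | yes _ | no a≁d | _ | _ | _ =
      K4-through-new-edge ad a≁d (≢-sym a≢b) b≢d (≢-sym a≢c) c≢d
        bc (~⁺-sym ab) bd (~⁺-sym ac) cd
    ... | yes _ | yes _ | yes _ | no b≁c | _ | _ =
      K4-through-new-edge bc b≁c a≢b a≢c (≢-sym b≢d) (≢-sym c≢d)
        ad ab ac (~⁺-sym bd) (~⁺-sym cd)
    ... | yes _ | yes _ | yes _ | yes _ | no b≁d | _ =
      K4-through-new-edge bd b≁d a≢b a≢d (≢-sym b≢c) c≢d
        ac ab ad (~⁺-sym bc) cd
    ... | yes _ | yes _ | yes _ | yes _ | yes _ | no c≁d =
      K4-through-new-edge cd c≁d a≢c a≢d b≢c b≢d ab ac ad bc bd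
    ... | yes a~b | yes a~c | yes a~d | yes b~c | yes b~d | yes c~d =
      ⊥-elim (K4-free (K4-of a~b a~c a~d b~c b~d c~d))

∣∩pair∣≤1-missing : ∀ {m} (T : Subset m) (j k : Fin m) → j ∉ T →
  ∣ T ∩ (⁅ j ⁆ ∪ ⁅ k ⁆) ∣ ≤ 1
∣∩pair∣≤1-missing T j k j∉T =
  subst (∣ T ∩ (⁅ j ⁆ ∪ ⁅ k ⁆) ∣ ≤_) (∣⁅x⁆∣≡1 k) (p⊆q⇒∣p∣≤∣q∣ only-k)
  where
  only-k : T ∩ (⁅ j ⁆ ∪ ⁅ k ⁆) ⊆ ⁅ k ⁆
  only-k m with x∈p∩q⁻ T (⁅ j ⁆ ∪ ⁅ k ⁆) m
  ... | m∈T , m∈jk with x∈p∪q⁻ ⁅ j ⁆ ⁅ k ⁆ m∈jk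
  ...   | inj₁ m∈j = contradiction (subst (_∈ T) (x∈⁅y⁆⇒x≡y j m∈j) m∈T) j∉T
  ...   | inj₂ m∈k = m∈k

∣∩pair∣≤1 : ∀ {m} (T : Subset m) (j k : Fin m) → ¬ (j ∈ T × k ∈ T) →
  ∣ T ∩ (⁅ j ⁆ ∪ ⁅ k ⁆) ∣ ≤ 1
∣∩pair∣≤1 T j k not-both with j ∈? T
... | no j∉T = ∣∩pair∣≤1-missing T j k j∉T
... | yes j∈T =
  subst (λ P → ∣ T ∩ P ∣ ≤ 1) (∪-comm ⁅ k ⁆ ⁅ j ⁆)
    (∣∩pair∣≤1-missing T k j λ k∈T → not-both (j∈T , k∈T))

module _ {n : ℕ} (G : Graph n) where

  trace : ∀ {m} → (Fin m → Fin n) → Fin n → Subset m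
  trace xs z = tabulate (λ j → adj G z (xs j))

  ∈-trace : ∀ {m} (xs : Fin m → Fin n) z j → Adj G z (xs j) ⇔ j ∈ trace xs z
  ∈-trace xs z j = mk⇔
    (λ zj → lookup⇒[]= j (trace xs z) (trans (lookup∘tabulate (λ j → adj G z (xs j)) j) zj))
    (λ j∈ → trans (≡-sym (lookup∘tabulate (λ j → adj G z (xs j)) j)) ([]=⇒lookup j∈))

  neighbour-in-Y : ∀ {x y z} → ¬ Adj G x y → Adj G y z → ¬ Adj G x z → InY G x z
  neighbour-in-Y x≁y yz x≁z = (λ { refl → x≁y (adj-sym G yz) }) , x≁z

  in-V-trace : ∀ {x} xs {z} → InY G x z → InV G x xs (trace xs z) z
  in-V-trace xs {z} z∈Y = z∈Y , ∈-trace xs z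

  -- If y ∈ V_S and z is a neighbour of y adjacent to xᵢ, then the trace
  -- of z lies in 𝒯_{S,i}: for an edge xⱼxₖ with j, k ∈ S, having both
  -- j, k in the trace would make y, z, xⱼ, xₖ a K₄.
  trace-in-𝒯 : ¬ HasK4 (adj G) → ∀ {x xs S i y z} → InV G x xs S y →
    Adj G y z → Adj G z (xs i) → In𝒯 G xs S i (trace xs z)
  trace-in-𝒯 K4-free {xs = xs} {S} {i} {y} {z} (_ , y-pattern) yz zxᵢ =
    Equivalence.to (∈-trace xs z i) zxᵢ , at-most-one
    where
    at-most-one : ∀ j k → j ∈ S → k ∈ S → Adj G (xs j) (xs k) →
      ∣ trace xs z ∩ (⁅ j ⁆ ∪ ⁅ k ⁆) ∣ ≤ 1
    at-most-one j k j∈S k∈S xⱼxₖ = ∣∩pair∣≤1 (trace xs z) j k λ (j∈T , k∈T) →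
      K4-free (K4-of G yz
        (Equivalence.from (y-pattern j) j∈S) (Equivalence.from (y-pattern k) k∈S)
        (Equivalence.from (∈-trace xs z j) j∈T) (Equivalence.from (∈-trace xs z k) k∈T)
        xⱼxₖ)

lemma3p1 : (n : ℕ) (G : Graph n) → K4-saturated G → minDegree4 G →
    (x : Fin n) → degree G x ≡ 4 →
    (xs : Fin 4 → Fin n) → Injective _≡_ _≡_ xs →
    (∀ v → Adj G x v ⇔ (∃[ j ] v ≡ xs j)) →
    (S : Subset 4) (i : Fin 4) → i ∉ S →
    (∃[ y ] InV G x xs S y) →
    (∀ y → InV G x xs S y →
      ∃[ T ] ∃[ z ] (In𝒯 G xs S i T × InV G x xs T z × Adj G y z))
lemma3p1 n G (K4-free , saturated) _ x _ xs _ N[x] S i i∉S _ y y∈V@((_ , x≁y) , y-pattern) =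
  from-common-edge (common-edge G y (xs i) K4-free (saturated y (xs i) y≢xᵢ y≁xᵢ))
  where
  x~xᵢ : Adj G x (xs i)
  x~xᵢ = Equivalence.from (N[x] (xs i)) (i , refl)

  y≢xᵢ : y ≢ xs i
  y≢xᵢ refl = x≁y x~xᵢ

  y≁xᵢ : ¬ Adj G y (xs i)
  y≁xᵢ y~xᵢ = i∉S (Equivalence.to (y-pattern i) y~xᵢ)

  witness : ∀ {z} → Adj G z y → Adj G z (xs i) → ¬ Adj G x z →
    ∃[ T ] ∃[ z ] (In𝒯 G xs S i T × InV G x xs T z × Adj G y z)
  witness {z} zy zxᵢ x≁z =
    trace G xs z , z , trace-in-𝒯 G K4-free y∈V (adj-sym G zy) zxᵢ ,
    in-V-trace G xs (neighbour-in-Y G x≁y (adj-sym G zy) x≁z) , adj-sym G zy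

  -- of the two adjacent common neighbours p, q one avoids N(x)
  from-common-edge : CommonEdge G y (xs i) →
    ∃[ T ] ∃[ z ] (In𝒯 G xs S i T × InV G x xs T z × Adj G y z)
  from-common-edge (p , q , pq , py , pxᵢ , qy , qxᵢ)
    with triangle-escapes G K4-free x~xᵢ pq (adj-sym G pxᵢ) (adj-sym G qxᵢ)
  ... | inj₁ x≁p = witness py pxᵢ x≁p
  ... | inj₂ x≁q = witness qy qxᵢ x≁q
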